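{- Let $G$ be a finite abelian group of order $n\ge 2$ and let $t\ge 2$ be an integer. Then $$\left(\frac{t!}{2^t}n\right)^{1/t}-\frac t2 < w(G,t) < \left(\left\lfloor\frac t2\right\rfloor!\,n\right)^{1/\lfloor t/2\rfloor}+\frac t2.$$
   Context: $G$ is written additively. For a non-negative integer $t$, a subset $A=\{a_1,\dots,a_m\}$ of $G$ (with $m\ge 1$) is called weakly $t$-independent if whenever $\lambda_1a_1+\cdots+\lambda_ma_m=0$ for integers $\lambda_1,\dots,\lambda_m\in\{ -1,0,1\}$ with $|\lambda_1|+\cdots+|\lambda_m|\le t$, we have $\lambda_1=\cdots=\lambda_m=0$. $w(G,t)$ denotes the maximum size of a weakly $t$-independent subset of $G$. -}

module Defs where

open import Level using (Level)
open import Data.Nat using (ℕ; zero; suc; _+_; _≤_)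
open import Data.Fin using (Fin; zero; suc)
open import Data.Product using (Σ; _×_; ∃)
open import Relation.Binary.PropositionalEquality using (_≡_)
open import Algebra.Bundles using (AbelianGroup)

data Coef : Set where
  neg zer pos : Coef

∣_∣c : Coef → ℕ
∣ neg ∣c = 1
∣ zer ∣c = 0
∣ pos ∣c = 1

module _ {c ℓ : Level} (G : AbelianGroup c ℓ) where
  open AbelianGroup G

  -- λ · a  for λ ∈ {-1,0,1}  (group written multiplicatively in the stdlib record:
  -- _∙_ is the group operation "+", ε is 0, _⁻¹ is negation)
  scale : Coef → Carrier → Carrier
  scale neg a = a ⁻¹
  scale zer a = ε
  scale pos a = a

  lincomb : (m : ℕ) → (Fin m → Coef) → (Fin m → Carrier) → Carrier
  lincomb zero    λs as = ε
  lincomb (suc m) λs as = scale (λs zero) (as zero) ∙ lincomb m (λ i → λs (suc i)) (λ i → as (suc i))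

  weight : (m : ℕ) → (Fin m → Coef) → ℕ
  weight zero    λs = 0
  weight (suc m) λs = ∣ λs zero ∣c + weight m (λ i → λs (suc i))

  HasOrder : ℕ → Set (c Level.⊔ ℓ)
  HasOrder n = Σ (Fin n → Carrier) λ e →
                 (∀ i j → e i ≈ e j → i ≡ j) × (∀ x → ∃ λ i → e i ≈ x)

  -- A = {a₁,…,aₘ} is an m-element subset of G: a₁,…,aₘ pairwise distinct.
  Distinct : (m : ℕ) → (Fin m → Carrier) → Set ℓ
  Distinct m as = ∀ i j → as i ≈ as j → i ≡ j

  WeaklyIndep : ℕ → (m : ℕ) → (Fin m → Carrier) → Set ℓ
  WeaklyIndep t m as =
    ∀ (λs : Fin m → Coef) → weight m λs ≤ t → lincomb m λs as ≈ ε → ∀ i → λs i ≡ zer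

  HasWeaklyIndepOfSize : ℕ → ℕ → Set (c Level.⊔ ℓ)
  HasWeaklyIndepOfSize t m =
    1 ≤ m × Σ (Fin m → Carrier) λ as → Distinct m as × WeaklyIndep t m as

  IsW : ℕ → ℕ → Set (c Level.⊔ ℓ)
  IsW t w = HasWeaklyIndepOfSize t w × (∀ m → HasWeaklyIndepOfSize t m → m ≤ w)

{-# OPTIONS --safe #-}
-- Let A be a weakly t-independent set of maximal size w.  By maximality every x ∈ G
-- is a {-1,0,1}-combination of A of weight < t: otherwise A ∪ {x} would still be
-- weakly t-independent.  So n is at most the number of vectors in {-1,0,1}^w of
-- weight < t, and (t-1)! times that number is at most (2w+t-1)^(t-1).  Conversely,
-- for k = ⌊t/2⌋ two different k-subsets of A with equal sums would give a vanishing
-- combination of weight ≤ 2k ≤ t, so C(w,k) ≤ n, while k!·C(w,k) ≥ (w-k+1)^k.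
module Submission where

open import Defs
open import Level using (Level)
open import Data.Nat
  using (ℕ; zero; suc; _+_; _*_; _∸_; _^_; _≤_; _<_; _/_; _!; z≤n; s≤s; >-nonZero)
open import Data.Nat.Properties
open import Data.Nat.DivMod using (m≥n⇒m/n>0; m/n*n≤m)
open import Data.Nat.Tactic.RingSolver using (solve-∀)
open import Algebra.Bundles using (AbelianGroup)
open import Data.Bool using (Bool; true; false)
open import Data.Fin using (Fin; zero; suc; splitAt; join; _↑ˡ_; _↑ʳ_)
open import Data.Fin.Properties using (splitAt-↑ˡ; splitAt-↑ʳ; join-splitAt; injective⇒≤; any?)
import Data.Fin.Properties as Fin
open import Data.Vec.Functional using (Vector; []; _∷_; tail; map; zipWith; replicate)
open import Data.Vec.Functional.Properties using (∷-cong)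
open import Data.Sum using (inj₁; inj₂; [_,_]′)
open import Data.Product using (_,_; _×_; proj₁; proj₂; ∃-syntax; uncurry)
open import Function using (_∘_)
open import Relation.Nullary using (¬_; Dec; yes; no; contradiction)
open import Relation.Nullary.Decidable using (map′)
open import Relation.Binary.PropositionalEquality
  using (_≡_; refl; sym; trans; cong; cong₂; subst; _≗_; module ≡-Reasoning)

∥_∥ : ∀ {m} → Vector Coef m → ℕ
∥_∥ {zero}  μ = 0
∥_∥ {suc m} μ = ∣ μ zero ∣c + ∥ tail μ ∥

fromBool : Bool → Coef
fromBool false = zer
fromBool true  = pos

negate : Coef → Coef
negate neg = pos
negate zer = zer
negate pos = neg

_⊖_ : Bool → Bool → Coef
false ⊖ false = zer
true  ⊖ true  = zer
true  ⊖ false = pos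
false ⊖ true  = neg

⊖≡zer⇒≡ : ∀ x y → x ⊖ y ≡ zer → x ≡ y
⊖≡zer⇒≡ false false _ = refl
⊖≡zer⇒≡ true  true  _ = refl

unit : ∀ {m} → Fin m → Vector Coef m
unit zero    = pos ∷ replicate _ zer
unit (suc i) = zer ∷ unit i

∥replicate-zer∥ : ∀ m → ∥ replicate m zer ∥ ≡ 0
∥replicate-zer∥ zero    = refl
∥replicate-zer∥ (suc m) = ∥replicate-zer∥ m

∥unit∥ : ∀ {m} (i : Fin m) → ∥ unit i ∥ ≡ 1
∥unit∥ {suc m} zero = cong suc (∥replicate-zer∥ m)
∥unit∥ (suc i)      = ∥unit∥ i

∥map-negate∥ : ∀ {m} (μ : Vector Coef m) → ∥ map negate μ ∥ ≡ ∥ μ ∥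
∥map-negate∥ {zero}  μ = refl
∥map-negate∥ {suc m} μ = cong₂ _+_ (∣negate∣ (μ zero)) (∥map-negate∥ (tail μ))
  where
  ∣negate∣ : ∀ c → ∣ negate c ∣c ≡ ∣ c ∣c
  ∣negate∣ neg = refl
  ∣negate∣ zer = refl
  ∣negate∣ pos = refl

∥zipWith-⊖∥ : ∀ {m} (b b′ : Vector Bool m) →
              ∥ zipWith _⊖_ b b′ ∥ ≤ ∥ map fromBool b ∥ + ∥ map fromBool b′ ∥
∥zipWith-⊖∥ {zero}  b b′ = z≤n
∥zipWith-⊖∥ {suc m} b b′ =
  ≤-trans (+-mono-≤ (∣⊖∣ (b zero) (b′ zero)) (∥zipWith-⊖∥ (tail b) (tail b′)))
          (≤-reflexive (interchange ∣ fromBool (b zero) ∣c ∣ fromBool (b′ zero) ∣c _ _))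
  where
  open import Algebra.Properties.CommutativeSemigroup +-commutativeSemigroup using (interchange)
  ∣⊖∣ : ∀ x y → ∣ x ⊖ y ∣c ≤ ∣ fromBool x ∣c + ∣ fromBool y ∣c
  ∣⊖∣ false false = z≤n
  ∣⊖∣ true  true  = z≤n
  ∣⊖∣ true  false = s≤s z≤n
  ∣⊖∣ false true  = s≤s z≤n

ballSize : ℕ → ℕ → ℕ
ballSize zero    s       = 1
ballSize (suc m) zero    = ballSize m zero
ballSize (suc m) (suc s) = ballSize m (suc s) + (ballSize m s + ballSize m s)

ballPoint : ∀ m s → Fin (ballSize m s) → Vector Coef m
ballPoint zero    s       _ = []
ballPoint (suc m) zero    j = zer ∷ ballPoint m zero j
ballPoint (suc m) (suc s) j =
  [ (zer ∷_) ∘ ballPoint m (suc s)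
  , [ (pos ∷_) ∘ ballPoint m s , (neg ∷_) ∘ ballPoint m s ]′ ∘ splitAt (ballSize m s)
  ]′ (splitAt (ballSize m (suc s)) j)

module _ {m s : ℕ} {ν : Vector Coef m} where

  ballPoint-zer : ∀ {j} → ballPoint m (suc s) j ≗ ν →
                  ballPoint (suc m) (suc s) (j ↑ˡ (ballSize m s + ballSize m s)) ≗ zer ∷ ν
  ballPoint-zer {j} eq rewrite splitAt-↑ˡ (ballSize m (suc s)) j (ballSize m s + ballSize m s) =
    ∷-cong refl eq

  ballPoint-pos : ∀ {j} → ballPoint m s j ≗ ν →
                  ballPoint (suc m) (suc s) (ballSize m (suc s) ↑ʳ (j ↑ˡ ballSize m s)) ≗ pos ∷ ν
  ballPoint-pos {j} eq
    rewrite splitAt-↑ʳ (ballSize m (suc s)) (ballSize m s + ballSize m s) (j ↑ˡ ballSize m s)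
          | splitAt-↑ˡ (ballSize m s) j (ballSize m s) = ∷-cong refl eq

  ballPoint-neg : ∀ {j} → ballPoint m s j ≗ ν →
                  ballPoint (suc m) (suc s) (ballSize m (suc s) ↑ʳ (ballSize m s ↑ʳ j)) ≗ neg ∷ ν
  ballPoint-neg {j} eq
    rewrite splitAt-↑ʳ (ballSize m (suc s)) (ballSize m s + ballSize m s) (ballSize m s ↑ʳ j)
          | splitAt-↑ʳ (ballSize m s) (ballSize m s) j = ∷-cong refl eq

ballPoint-surjective : ∀ {m} s (μ : Vector Coef m) → ∥ μ ∥ ≤ s → ∃[ j ] ballPoint m s j ≗ μ
ballPoint-surjective {zero}  s μ _ = zero , λ ()
ballPoint-surjective {suc m} s μ ∥μ∥≤s =
  let j , eq = ∷-surjective s (μ zero) ∥μ∥≤s in j , ∷-cong (eq zero) (eq ∘ suc)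
  where
  ∷-surjective : ∀ s c → ∣ c ∣c + ∥ tail μ ∥ ≤ s → ∃[ j ] ballPoint (suc m) s j ≗ c ∷ tail μ
  ∷-surjective zero zer h =
    let j , eq = ballPoint-surjective zero (tail μ) h in j , ∷-cong refl eq
  ∷-surjective (suc s) zer h =
    let _ , eq = ballPoint-surjective (suc s) (tail μ) h in _ , ballPoint-zer eq
  ∷-surjective (suc s) pos (s≤s h) =
    let _ , eq = ballPoint-surjective s (tail μ) h in _ , ballPoint-pos eq
  ∷-surjective (suc s) neg (s≤s h) =
    let _ , eq = ballPoint-surjective s (tail μ) h in _ , ballPoint-neg eq

-- Pascal's rule rather than Data.Nat.Combinatorics._C_, so that Fin (binomial (suc m) (suc k))
-- splits definitionally into the two halves enumerated by subset.
binomial : ℕ → ℕ → ℕ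
binomial m       zero    = 1
binomial zero    (suc k) = 0
binomial (suc m) (suc k) = binomial m (suc k) + binomial m k

subset : ∀ m k → Fin (binomial m k) → Vector Bool m
subset m       zero    _ = replicate m false
subset (suc m) (suc k) j =
  [ (false ∷_) ∘ subset m (suc k) , (true ∷_) ∘ subset m k ]′ (splitAt (binomial m (suc k)) j)

splitAt-injective : ∀ m {n} {i j : Fin (m + n)} → splitAt m i ≡ splitAt m j → i ≡ j
splitAt-injective m {n} {i} {j} eq =
  trans (sym (join-splitAt m n i)) (trans (cong (join m n) eq) (join-splitAt m n j))

subset-injective : ∀ m k {i j} → subset m k i ≗ subset m k j → i ≡ j
subset-injective m       zero    {zero} {zero} _ = refl
subset-injective (suc m) (suc k) {i} {j} eq =
  splitAt-injective (binomial m (suc k)) (halves (splitAt _ i) (splitAt _ j) eq)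
  where
  halves : ∀ x y →
           [ (false ∷_) ∘ subset m (suc k) , (true ∷_) ∘ subset m k ]′ x ≗
           [ (false ∷_) ∘ subset m (suc k) , (true ∷_) ∘ subset m k ]′ y → x ≡ y
  halves (inj₁ _) (inj₁ _) eq = cong inj₁ (subset-injective m (suc k) (eq ∘ suc))
  halves (inj₁ _) (inj₂ _) eq = contradiction (eq zero) λ ()
  halves (inj₂ _) (inj₁ _) eq = contradiction (eq zero) λ ()
  halves (inj₂ _) (inj₂ _) eq = cong inj₂ (subset-injective m k (eq ∘ suc))

∥subset∥ : ∀ m k j → ∥ map fromBool (subset m k j) ∥ ≡ k
∥subset∥ m       zero    _ = ∥replicate-zer∥ m
∥subset∥ (suc m) (suc k) j = halves (splitAt (binomial m (suc k)) j)
  where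
  halves : ∀ x →
           ∥ map fromBool ([ (false ∷_) ∘ subset m (suc k) , (true ∷_) ∘ subset m k ]′ x) ∥ ≡ suc k
  halves (inj₁ a) = ∥subset∥ m (suc k) a
  halves (inj₂ b) = cong suc (∥subset∥ m k b)

n!≤n^n : ∀ n → n ! ≤ n ^ n
n!≤n^n zero    = ≤-refl
n!≤n^n (suc n) = *-monoʳ-≤ (suc n) (≤-trans (n!≤n^n n) (^-monoˡ-≤ n (n≤1+n n)))

[x+y]^[1+j]-lowerBound : ∀ x y j → x ^ suc j + suc j * y * x ^ j ≤ (x + y) ^ suc j
[x+y]^[1+j]-lowerBound x y zero    = ≤-reflexive (linear x y)
  where
  linear : ∀ x y → x * 1 + 1 * y * 1 ≡ (x + y) * 1
  linear = solve-∀
[x+y]^[1+j]-lowerBound x y (suc j) = begin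
  x ^ suc (suc j) + suc (suc j) * y * x ^ suc j
    ≤⟨ m≤m+n _ (suc j * y * y * x ^ j) ⟩
  x ^ suc (suc j) + suc (suc j) * y * x ^ suc j + suc j * y * y * x ^ j
    ≡⟨ expand x y j (x ^ j) ⟩
  (x + y) * (x ^ suc j + suc j * y * x ^ j)
    ≤⟨ *-monoʳ-≤ (x + y) ([x+y]^[1+j]-lowerBound x y j) ⟩
  (x + y) ^ suc (suc j) ∎
  where
  open ≤-Reasoning
  expand : ∀ x y j p → x * (x * p) + suc (suc j) * y * (x * p) + suc j * y * y * p ≡
                       (x + y) * (x * p + suc j * y * p)
  expand = solve-∀

ballSize-upperBound : ∀ m s → s ! * ballSize m s ≤ (2 * m + s) ^ s
ballSize-upperBound zero    s       = ≤-trans (≤-reflexive (*-identityʳ (s !))) (n!≤n^n s)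
ballSize-upperBound (suc m) zero    = ballSize-upperBound m zero
ballSize-upperBound (suc m) (suc s) = begin
  suc s ! * (ballSize m (suc s) + (ballSize m s + ballSize m s))
    ≡⟨ split (s !) s (ballSize m (suc s)) (ballSize m s) ⟩
  suc s ! * ballSize m (suc s) + suc s * 2 * (s ! * ballSize m s)
    ≤⟨ +-mono-≤ (ballSize-upperBound m (suc s))
                (*-monoʳ-≤ (suc s * 2) (≤-trans (ballSize-upperBound m s)
                                                (^-monoˡ-≤ s (+-monoʳ-≤ (2 * m) (n≤1+n s))))) ⟩
  (2 * m + suc s) ^ suc s + suc s * 2 * (2 * m + suc s) ^ s
    ≤⟨ [x+y]^[1+j]-lowerBound (2 * m + suc s) 2 s ⟩
  (2 * m + suc s + 2) ^ suc s
    ≡⟨ cong (_^ suc s) (shift m s) ⟩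
  (2 * suc m + suc s) ^ suc s ∎
  where
  open ≤-Reasoning
  split : ∀ f s a b → suc s * f * (a + (b + b)) ≡ suc s * f * a + suc s * 2 * (f * b)
  split = solve-∀
  shift : ∀ m s → 2 * m + suc s + 2 ≡ 2 * suc m + suc s
  shift = solve-∀

binomial-absorption : ∀ m k → suc k * binomial (suc m) (suc k) ≡ suc m * binomial m k
binomial-absorption zero    zero    = refl
binomial-absorption zero    (suc k) = *-zeroʳ (suc (suc k))
binomial-absorption (suc m) k       = begin
  suc k * (binomial (suc m) (suc k) + binomial (suc m) k)
    ≡⟨ *-distribˡ-+ (suc k) (binomial (suc m) (suc k)) _ ⟩
  suc k * binomial (suc m) (suc k) + suc k * binomial (suc m) k
    ≡⟨ cong (_+ suc k * binomial (suc m) k) (binomial-absorption m k) ⟩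
  suc m * binomial m k + suc k * binomial (suc m) k
    ≡⟨ pascal k ⟩
  suc (suc m) * binomial (suc m) k ∎
  where
  open ≡-Reasoning
  collect₀ : ∀ m → suc m * 1 + 1 * 1 ≡ suc (suc m) * 1
  collect₀ = solve-∀
  collect : ∀ m a b → suc m * a + ((a + b) + suc m * b) ≡ suc (suc m) * (a + b)
  collect = solve-∀
  pascal : ∀ k → suc m * binomial m k + suc k * binomial (suc m) k ≡
                 suc (suc m) * binomial (suc m) k
  pascal zero    = collect₀ m
  pascal (suc k) = begin
    suc m * binomial m (suc k) + (binomial (suc m) (suc k) + suc k * binomial (suc m) (suc k))
      ≡⟨ cong (λ x → suc m * binomial m (suc k) + (binomial (suc m) (suc k) + x))
              (binomial-absorption m k) ⟩
    suc m * binomial m (suc k) + (binomial (suc m) (suc k) + suc m * binomial m k)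
      ≡⟨ collect m (binomial m (suc k)) (binomial m k) ⟩
    suc (suc m) * binomial (suc m) (suc k) ∎

binomial-lowerBound : ∀ m k → suc m ^ k ≤ k ! * binomial (k + m) k
binomial-lowerBound m zero    = ≤-refl
binomial-lowerBound m (suc k) = begin
  suc m * suc m ^ k
    ≤⟨ *-mono-≤ (s≤s (m≤n+m m k)) (binomial-lowerBound m k) ⟩
  suc (k + m) * (k ! * binomial (k + m) k)
    ≡⟨ x∙yz≈y∙xz (suc (k + m)) (k !) _ ⟩
  k ! * (suc (k + m) * binomial (k + m) k)
    ≡⟨ cong (k ! *_) (binomial-absorption (k + m) k) ⟨
  k ! * (suc k * binomial (suc (k + m)) (suc k))
    ≡⟨ x∙yz≈y∙xz (k !) (suc k) _ ⟩
  suc k * (k ! * binomial (suc (k + m)) (suc k))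
    ≡⟨ *-assoc (suc k) (k !) _ ⟨
  suc k ! * binomial (suc k + m) (suc k) ∎
  where
  open ≤-Reasoning
  open import Algebra.Properties.CommutativeSemigroup *-commutativeSemigroup using (x∙yz≈y∙xz)

[m*n]^k≡m^k*n^k : ∀ m n k → (m * n) ^ k ≡ m ^ k * n ^ k
[m*n]^k≡m^k*n^k m n zero    = refl
[m*n]^k≡m^k*n^k m n (suc k) =
  trans (cong (m * n *_) ([m*n]^k≡m^k*n^k m n k)) (interchange m n (m ^ k) (n ^ k))
  where
  open import Algebra.Properties.CommutativeSemigroup *-commutativeSemigroup using (interchange)

t!*n<[2w+t]^t : ∀ {w s n} → 1 ≤ w → n ≤ ballSize w s → suc s ! * n < (2 * w + suc s) ^ suc s
t!*n<[2w+t]^t {w} {s} {n} 1≤w n≤ballSize = begin-strict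
  suc s * s ! * n
    ≤⟨ *-monoʳ-≤ (suc s !) n≤ballSize ⟩
  suc s * s ! * ballSize w s
    ≡⟨ *-assoc (suc s) (s !) (ballSize w s) ⟩
  suc s * (s ! * ballSize w s)
    ≤⟨ *-monoʳ-≤ (suc s) (≤-trans (ballSize-upperBound w s)
                                  (^-monoˡ-≤ s (+-monoʳ-≤ (2 * w) (n≤1+n s)))) ⟩
  suc s * (2 * w + suc s) ^ s
    <⟨ *-monoˡ-< ((2 * w + suc s) ^ s) {{m^n≢0 _ s {{>-nonZero (<-trans 0<1+n t<2w+t)}}}} t<2w+t ⟩
  (2 * w + suc s) ^ suc s ∎
  where
  open ≤-Reasoning
  t<2w+t : suc s < 2 * w + suc s
  t<2w+t = m<n+m (suc s) (*-monoʳ-< 2 1≤w)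

[2w∸t]^k<2^k*k!*n : ∀ {w t k n} → 1 ≤ k → 2 * k ≤ t → 1 ≤ n → binomial w k ≤ n →
                    (2 * w ∸ t) ^ k < 2 ^ k * k ! * n
[2w∸t]^k<2^k*k!*n {w} {t} {k} {n} (s≤s z≤n) 2k≤t 1≤n binomial≤n with ≤-<-connex k w
... | inj₂ w<k rewrite m≤n⇒m∸n≡0 (≤-trans (*-monoʳ-≤ 2 (<⇒≤ w<k)) 2k≤t) =
  *-mono-≤ (*-mono-≤ (m^n>0 2 k) (1≤n! k)) 1≤n
... | inj₁ k≤w with o , refl ← m≤n⇒∃[o]m+o≡n k≤w = begin-strict
  (2 * (k + o) ∸ t) ^ k
    <⟨ ^-monoˡ-< k base< ⟩
  (2 * suc o) ^ k
    ≡⟨ [m*n]^k≡m^k*n^k 2 (suc o) k ⟩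
  2 ^ k * suc o ^ k
    ≤⟨ *-monoʳ-≤ (2 ^ k) (≤-trans (binomial-lowerBound o k) (*-monoʳ-≤ (k !) binomial≤n)) ⟩
  2 ^ k * (k ! * n)
    ≡⟨ *-assoc (2 ^ k) (k !) n ⟨
  2 ^ k * k ! * n ∎
  where
  open ≤-Reasoning
  base< : 2 * (k + o) ∸ t < 2 * suc o
  base< = begin-strict
    2 * (k + o) ∸ t       ≤⟨ ∸-monoʳ-≤ (2 * (k + o)) 2k≤t ⟩
    2 * (k + o) ∸ 2 * k   ≡⟨ cong (_∸ 2 * k) (*-distribˡ-+ 2 k o) ⟩
    2 * k + 2 * o ∸ 2 * k ≡⟨ m+n∸m≡n (2 * k) (2 * o) ⟩
    2 * o                 <⟨ *-monoʳ-< 2 (n<1+n o) ⟩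
    2 * suc o             ∎

module _ {c ℓ : Level} (G : AbelianGroup c ℓ) where

  open AbelianGroup G hiding (refl; sym; trans)
  open AbelianGroup G using () renaming (refl to ≈-refl; sym to ≈-sym; trans to ≈-trans)
  open import Algebra.Properties.AbelianGroup G
    using (⁻¹-∙-comm; ε⁻¹≈ε; ⁻¹-involutive; inverseˡ-unique; ⁻¹-injective; x≈y⇒x∙y⁻¹≈ε)
  open import Algebra.Properties.CommutativeSemigroup commutativeSemigroup using (interchange)

  weight≡∥∥ : ∀ m (μ : Vector Coef m) → weight G m μ ≡ ∥ μ ∥
  weight≡∥∥ zero    μ = refl
  weight≡∥∥ (suc m) μ = cong (∣ μ zero ∣c +_) (weight≡∥∥ m (tail μ))

  lincomb-cong : ∀ m {μ ν} (as : Vector Carrier m) → μ ≗ ν → lincomb G m μ as ≈ lincomb G m ν as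
  lincomb-cong zero    as eq = ≈-refl
  lincomb-cong (suc m) as eq =
    ∙-cong (reflexive (cong (λ c → scale G c (as zero)) (eq zero)))
           (lincomb-cong m (tail as) (eq ∘ suc))

  lincomb-replicate-zer : ∀ m (as : Vector Carrier m) → lincomb G m (replicate m zer) as ≈ ε
  lincomb-replicate-zer zero    as = ≈-refl
  lincomb-replicate-zer (suc m) as = ≈-trans (identityˡ _) (lincomb-replicate-zer m (tail as))

  lincomb-unit : ∀ m (i : Fin m) (as : Vector Carrier m) → lincomb G m (unit i) as ≈ as i
  lincomb-unit (suc m) zero    as =
    ≈-trans (∙-congˡ (lincomb-replicate-zer m (tail as))) (identityʳ _)
  lincomb-unit (suc m) (suc i) as = ≈-trans (identityˡ _) (lincomb-unit m i (tail as))

  lincomb-∙⁻¹ : ∀ m (μ ν ρ : Vector Coef m) (as : Vector Carrier m) →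
                (∀ i → scale G (μ i) (as i) ≈ scale G (ν i) (as i) ∙ scale G (ρ i) (as i) ⁻¹) →
                lincomb G m μ as ≈ lincomb G m ν as ∙ lincomb G m ρ as ⁻¹
  lincomb-∙⁻¹ zero    μ ν ρ as _  = ≈-sym (inverseʳ ε)
  lincomb-∙⁻¹ (suc m) μ ν ρ as eq = begin
    scale G (μ zero) a ∙ lincomb G m (tail μ) (tail as)
      ≈⟨ ∙-cong (eq zero) (lincomb-∙⁻¹ m (tail μ) (tail ν) (tail ρ) (tail as) (eq ∘ suc)) ⟩
    (x ∙ y ⁻¹) ∙ (X ∙ Y ⁻¹)
      ≈⟨ interchange x (y ⁻¹) X (Y ⁻¹) ⟩
    (x ∙ X) ∙ (y ⁻¹ ∙ Y ⁻¹)
      ≈⟨ ∙-congˡ (⁻¹-∙-comm y Y) ⟩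
    (x ∙ X) ∙ (y ∙ Y) ⁻¹ ∎
    where
    open import Relation.Binary.Reasoning.Setoid setoid
    a x y X Y : Carrier
    a = as zero
    x = scale G (ν zero) a
    y = scale G (ρ zero) a
    X = lincomb G m (tail ν) (tail as)
    Y = lincomb G m (tail ρ) (tail as)

  lincomb-negate : ∀ m (μ : Vector Coef m) (as : Vector Carrier m) →
                   lincomb G m (map negate μ) as ≈ lincomb G m μ as ⁻¹
  lincomb-negate m μ as =
    ≈-trans (lincomb-∙⁻¹ m (map negate μ) (replicate m zer) μ as (λ i → scale-negate (μ i) (as i)))
          (≈-trans (∙-congʳ (lincomb-replicate-zer m as)) (identityˡ _))
    where
    scale-negate : ∀ c a → scale G (negate c) a ≈ ε ∙ scale G c a ⁻¹
    scale-negate neg a = ≈-sym (≈-trans (identityˡ _) (⁻¹-involutive a))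
    scale-negate zer a = ≈-sym (≈-trans (identityˡ _) ε⁻¹≈ε)
    scale-negate pos a = ≈-sym (identityˡ _)

  lincomb-⊖ : ∀ m (b b′ : Vector Bool m) (as : Vector Carrier m) →
              lincomb G m (zipWith _⊖_ b b′) as ≈
              lincomb G m (map fromBool b) as ∙ lincomb G m (map fromBool b′) as ⁻¹
  lincomb-⊖ m b b′ as = lincomb-∙⁻¹ m _ _ _ as (λ i → scale-⊖ (b i) (b′ i) (as i))
    where
    scale-⊖ : ∀ x y a → scale G (x ⊖ y) a ≈ scale G (fromBool x) a ∙ scale G (fromBool y) a ⁻¹
    scale-⊖ false false a = ≈-sym (inverseʳ ε)
    scale-⊖ true  true  a = ≈-sym (inverseʳ a)
    scale-⊖ true  false a = ≈-sym (≈-trans (∙-congˡ ε⁻¹≈ε) (identityʳ a))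
    scale-⊖ false true  a = ≈-sym (identityˡ (a ⁻¹))

  Representable : ℕ → (m : ℕ) → Vector Carrier m → Carrier → Set ℓ
  Representable s m as x = ∃[ μ ] ∥ μ ∥ ≤ s × lincomb G m μ as ≈ x

  element-representable : ∀ {s m as x} → 1 ≤ s → ∀ i → as i ≈ x → Representable s m as x
  element-representable {m = m} {as} 1≤s i aᵢ≈x =
    unit i , subst (_≤ _) (sym (∥unit∥ i)) 1≤s , ≈-trans (lincomb-unit m i as) aᵢ≈x

  ∷-distinct : ∀ {s m as x} → 1 ≤ s → ¬ Representable s m as x →
               Distinct G m as → Distinct G (suc m) (x ∷ as)
  ∷-distinct _   _    _        zero    zero    _     = refl
  ∷-distinct 1≤s ¬rep _        zero    (suc j) x≈aⱼ  =
    contradiction (element-representable 1≤s j (≈-sym x≈aⱼ)) ¬rep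
  ∷-distinct 1≤s ¬rep _        (suc i) zero    aᵢ≈x  =
    contradiction (element-representable 1≤s i aᵢ≈x) ¬rep
  ∷-distinct _   _    distinct (suc i) (suc j) aᵢ≈aⱼ = cong suc (distinct i j aᵢ≈aⱼ)

  ∷-weaklyIndep : ∀ {s m as x} → ¬ Representable s m as x →
                  WeaklyIndep G (suc s) m as → WeaklyIndep G (suc s) (suc m) (x ∷ as)
  ∷-weaklyIndep {s} {m} {as} {x} ¬rep indep λs weight≤1+s sum≈ε =
    uncurry ∷-cong (head-and-tail (λs zero) (tail λs) weight≤1+s sum≈ε)
    where
    head-and-tail : ∀ c ν → ∣ c ∣c + weight G m ν ≤ suc s → scale G c x ∙ lincomb G m ν as ≈ ε →
                    c ≡ zer × (∀ i → ν i ≡ zer)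
    head-and-tail zer ν wt eq = refl , indep ν wt (≈-trans (≈-sym (identityˡ _)) eq)
    head-and-tail pos ν (s≤s wt) eq = contradiction
      (map negate ν , subst (_≤ s) (trans (weight≡∥∥ m ν) (sym (∥map-negate∥ ν))) wt ,
       ≈-trans (lincomb-negate m ν as) (≈-sym (inverseˡ-unique x _ eq)))
      ¬rep
    head-and-tail neg ν (s≤s wt) eq = contradiction
      (ν , subst (_≤ s) (weight≡∥∥ m ν) wt , ≈-sym (⁻¹-injective (inverseˡ-unique (x ⁻¹) _ eq)))
      ¬rep

  subsetSum : ∀ {m} → Vector Carrier m → Vector Bool m → Carrier
  subsetSum {m} as b = lincomb G m (map fromBool b) as

  subsetSum-injective : ∀ {t m as} → WeaklyIndep G t m as → ∀ (b b′ : Vector Bool m) →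
                        ∥ map fromBool b ∥ + ∥ map fromBool b′ ∥ ≤ t →
                        subsetSum as b ≈ subsetSum as b′ → b ≗ b′
  subsetSum-injective {t} {m} {as} indep b b′ size≤t eq i =
    ⊖≡zer⇒≡ (b i) (b′ i) (indep (zipWith _⊖_ b b′) weight≤t difference≈ε i)
    where
    weight≤t : weight G m (zipWith _⊖_ b b′) ≤ t
    weight≤t = ≤-trans (≤-reflexive (weight≡∥∥ m _)) (≤-trans (∥zipWith-⊖∥ b b′) size≤t)
    difference≈ε : lincomb G m (zipWith _⊖_ b b′) as ≈ ε
    difference≈ε = ≈-trans (lincomb-⊖ m b b′ as) (x≈y⇒x∙y⁻¹≈ε eq)

  module _ {n : ℕ} (order : HasOrder G n) where

    private
      e : Fin n → Carrier
      e = proj₁ order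

      e-injective : ∀ i j → e i ≈ e j → i ≡ j
      e-injective = proj₁ (proj₂ order)

      index : Carrier → Fin n
      index x = proj₁ (proj₂ (proj₂ order) x)

      e-index : ∀ x → e (index x) ≈ x
      e-index x = proj₂ (proj₂ (proj₂ order) x)

      index-injective : ∀ {x y} → index x ≡ index y → x ≈ y
      index-injective {x} {y} eq =
        ≈-trans (≈-sym (e-index x)) (≈-trans (reflexive (cong e eq)) (e-index y))

    injective⇒≤order : ∀ {m} (f : Fin m → Carrier) → (∀ i j → f i ≈ f j → i ≡ j) → m ≤ n
    injective⇒≤order f f-injective = injective⇒≤ (f-injective _ _ ∘ index-injective)

    surjective⇒order≤ : ∀ {m} (f : Fin m → Carrier) → (∀ x → ∃[ i ] f i ≈ x) → n ≤ m
    surjective⇒order≤ f f-surjective = injective⇒≤ λ {i} {j} eq →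
      e-injective i j (≈-trans (≈-sym (preimage i)) (≈-trans (reflexive (cong f eq)) (preimage j)))
      where
      preimage : ∀ i → f (proj₁ (f-surjective (e i))) ≈ e i
      preimage i = proj₂ (f-surjective (e i))

    _≈?_ : ∀ x y → Dec (x ≈ y)
    x ≈? y = map′ index-injective
                  (λ x≈y → e-injective _ _ (≈-trans (e-index x) (≈-trans x≈y (≈-sym (e-index y)))))
                  (index x Fin.≟ index y)

    order≤ballSize : ∀ {s w as} → 1 ≤ s → Distinct G w as → WeaklyIndep G (suc s) w as →
                     (∀ m → HasWeaklyIndepOfSize G (suc s) m → m ≤ w) → n ≤ ballSize w s
    order≤ballSize {s} {w} {as} 1≤s distinct indep maximal = surjective⇒order≤ point covers
      where
      point : Fin (ballSize w s) → Carrier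
      point j = lincomb G w (ballPoint w s j) as
      covers : ∀ x → ∃[ j ] point j ≈ x
      covers x with any? (λ j → point j ≈? x)
      ... | yes found = found
      ... | no ¬found = contradiction
        (maximal (suc w)
          (s≤s z≤n , x ∷ as , ∷-distinct 1≤s ¬rep distinct , ∷-weaklyIndep ¬rep indep))
        1+n≰n
        where
        ¬rep : ¬ Representable s w as x
        ¬rep (μ , ∥μ∥≤s , μ≈x) =
          let j , eq = ballPoint-surjective s μ ∥μ∥≤s
          in  ¬found (j , ≈-trans (lincomb-cong w as eq) μ≈x)

    binomial≤order : ∀ {t m k as} → WeaklyIndep G t m as → 2 * k ≤ t → binomial m k ≤ n
    binomial≤order {t} {m} {k} {as} indep 2k≤t =
      injective⇒≤order (subsetSum as ∘ subset m k) λ i j eq →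
        subset-injective m k (subsetSum-injective indep (subset m k i) (subset m k j) size≤t eq)
      where
      size≤t : ∀ {i j} → ∥ map fromBool (subset m k i) ∥ + ∥ map fromBool (subset m k j) ∥ ≤ t
      size≤t {i} {j} = subst (_≤ t) (cong₂ _+_ (sym (∥subset∥ m k i)) (sym (∥subset∥ m k j)))
                             (subst (λ x → k + x ≤ t) (+-identityʳ k) 2k≤t)

theorem18 : ∀ {c ℓ : Level} (G : AbelianGroup c ℓ) (n t w : ℕ) →
    HasOrder G n → 2 ≤ n → 2 ≤ t → IsW G t w →
    (t ! * n < (2 * w + t) ^ t)
    × ((2 * w ∸ t) ^ (t / 2) < 2 ^ (t / 2) * ((t / 2) !) * n)
theorem18 G n t w order 2≤n 2≤t@(s≤s 1≤s) ((1≤w , as , distinct , indep) , maximal) =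
    t!*n<[2w+t]^t 1≤w (order≤ballSize G order 1≤s distinct indep maximal)
  , [2w∸t]^k<2^k*k!*n {k = t / 2} (m≥n⇒m/n>0 2≤t) 2k≤t (≤-trans (s≤s z≤n) 2≤n)
                      (binomial≤order G order {k = t / 2} indep 2k≤t)
  where
  2k≤t : 2 * (t / 2) ≤ t
  2k≤t = subst (_≤ t) (*-comm (t / 2) 2) (m/n*n≤m t 2)
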